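{- Let $(a_n)_{n\ge1}$ be an E-sequence such that (i) $3^n>2^{b_n}$ for all $n\ge1$, where $b_n=\sum_{i=1}^na_i$; and (ii) there is a constant $c>\log_2 3$ such that there are infinitely many distinct pairs $(k,l)$ of positive integers with $l>kc$ and $a_{k+1}=\cdots=a_l=1$. Then $(a_n)$ is $\Omega$-divergent.
   Context: An E-sequence is any infinite sequence $(a_n)_{n\ge1}$ of positive integers. For an odd positive integer $x$, its E-sequence is defined by $x_0=x$ and, for $n\ge1$, $x_n=\frac{3x_{n-1}+1}{2^{a_n}}$, where $a_n$ is the exponent of the largest power of $2$ dividing $3x_{n-1}+1$. An E-sequence is $\Omega$-divergent if it is not the E-sequence of any odd positive integer. -}

module Defs where

open import Data.Nat using (ℕ; zero; suc; _+_; _*_; _^_; _≤_; _<_)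
open import Data.Nat.Divisibility using (_∣_)
open import Data.Product using (Σ; ∃; _×_)
open import Relation.Nullary using (¬_)
open import Relation.Binary.PropositionalEquality using (_≡_)

-- Sequences indexed by n ≥ 1 are modelled as functions ℕ → ℕ; the value at 0 is ignored.

IsESequence : (ℕ → ℕ) → Set
IsESequence a = ∀ n → 1 ≤ n → 1 ≤ a n

OddPos : ℕ → Set
OddPos x = 1 ≤ x × ¬ (2 ∣ x)

-- (a_n) is the E-sequence of x: there is a trajectory xs with xs 0 = x and, for n ≥ 1,
-- a_n is the exponent of the largest power of 2 dividing 3 xs(n-1) + 1, and
-- xs n = (3 xs(n-1) + 1) / 2^{a_n}  (written multiplicatively).
IsESequenceOf : ℕ → (ℕ → ℕ) → Set
IsESequenceOf x a =
  Σ (ℕ → ℕ) λ xs →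
    (xs 0 ≡ x) ×
    (∀ n → (2 ^ a (suc n) ∣ 3 * xs n + 1)
         × ¬ (2 ^ (a (suc n) + 1) ∣ 3 * xs n + 1)
         × (xs (suc n) * 2 ^ a (suc n) ≡ 3 * xs n + 1))

ΩDivergent : (ℕ → ℕ) → Set
ΩDivergent a = ¬ (Σ ℕ λ x → OddPos x × IsESequenceOf x a)

b : (ℕ → ℕ) → ℕ → ℕ
b a zero = 0
b a (suc n) = b a n + a (suc n)

module Submission where

-- Suppose (a_n) were the E-sequence of x, with trajectory
-- x_0 = x, x_1, x_2, ...  Two facts about any trajectory are used:
--   * growth: since every a_n ≥ 1, 2(x_{n+1} + 1) ≤ 3(x_n + 1), hence
--     2^n (x_n + 1) ≤ 3^n (x_0 + 1);
--   * runs of ones: if a_{k+1} = ... = a_l = 1 then 2(x_{i+1} + 1) = 3(x_i + 1)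
--     along the run, so 2^(l-k) divides x_k + 1 (3 is odd).
-- Together: 2^l ≤ 2^k (x_k + 1) ≤ 3^k (x_0 + 1).  Write the slope condition as
-- 3^q < 2^p and k p < l q, put T = 3^q and M = (x_0 + 1)^q; raising to the
-- q-th power gives (T + 1)^k ≤ 2^(pk) < 2^(lq) ≤ T^k M.  By Bernoulli's
-- inequality (T + 1)^k ≥ T^k M as soon as k ≥ T M, so k < T M, and then
-- l < 2^l ≤ 3^(T M) (x_0 + 1).  Thus runs of slope above log₂ 3 have bounded
-- length, contradicting the existence of such runs with arbitrarily large l.

open import Defs
open import Data.Nat using (ℕ; zero; suc; _+_; _*_; _^_; _≤_; _<_; z≤n; s≤s; _∸_; NonZero; >-nonZero; _≤?_)
open import Data.Nat.Properties
open import Data.Nat.Divisibility using (_∣_; divides; ∣-trans; m∣m*n; *-cancelˡ-∣; *-monoʳ-∣; ∣⇒≤; 1∣_)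
open import Data.Nat.Coprimality using (Coprime; coprime-divisor; gcd≡1⇒coprime)
open import Data.Nat.Tactic.RingSolver using (solve-∀)
open import Data.Product using (Σ; _×_; _,_; proj₂)
open import Data.Sum using (inj₁; inj₂)
open import Relation.Nullary using (yes; no; contradiction)
open import Relation.Binary.PropositionalEquality

^-distribʳ-* : ∀ m n k → (m * n) ^ k ≡ m ^ k * n ^ k
^-distribʳ-* m n zero = refl
^-distribʳ-* m n (suc k) = begin
  m * n * (m * n) ^ k       ≡⟨ cong (m * n *_) (^-distribʳ-* m n k) ⟩
  m * n * (m ^ k * n ^ k)   ≡⟨ swap-middle m n (m ^ k) (n ^ k) ⟩
  m * m ^ k * (n * n ^ k)   ∎
  where
  open ≡-Reasoning
  swap-middle : ∀ a b c d → a * b * (c * d) ≡ a * c * (b * d)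
  swap-middle = solve-∀

n<2^n : ∀ n → n < 2 ^ n
n<2^n zero = s≤s z≤n
n<2^n (suc n) = +-mono-≤-< (^-monoʳ-≤ 2 {0} {n} z≤n) (subst (n <_) (sym (+-identityʳ (2 ^ n))) (n<2^n n))

+1-nonZero : ∀ y → NonZero (y + 1)
+1-nonZero y = >-nonZero (m≤n+m 1 y)

coprime-pow-divisor : ∀ p c m j .{{_ : NonZero p}} → Coprime p c → p ^ j ∣ c * m → p ^ j ∣ m
coprime-pow-divisor p c m zero _ _ = 1∣ m
coprime-pow-divisor p c m (suc j) cop pʲ⁺¹∣cm
  with coprime-divisor {o = m} cop (∣-trans (m∣m*n (p ^ j)) pʲ⁺¹∣cm)
... | divides r refl = subst (p ^ suc j ∣_) (*-comm p r) (*-monoʳ-∣ p pʲ∣r)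
  where
  regroup : ∀ c r p → c * (r * p) ≡ p * (c * r)
  regroup = solve-∀
  pʲ∣r : p ^ j ∣ r
  pʲ∣r = coprime-pow-divisor p c r j cop
           (*-cancelˡ-∣ p (subst (p ^ suc j ∣_) (regroup c r p) pʲ⁺¹∣cm))

-- Bernoulli's inequality (1 + 1/T)^n ≥ 1 + n/T, cleared of denominators.
bernoulli : ∀ T n → T ^ n * (T + n) ≤ T * suc T ^ n
bernoulli T zero = ≤-reflexive (trans (*-identityˡ (T + 0)) (trans (+-identityʳ T) (sym (*-identityʳ T))))
bernoulli T (suc n) = begin
  T * T ^ n * (T + suc n)     ≡⟨ regroup T (T ^ n) (T + suc n) ⟩
  T ^ n * (T * (T + suc n))   ≤⟨ *-monoʳ-≤ (T ^ n) (≤-trans (m≤m+n _ n) (≤-reflexive (expand T n))) ⟩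
  T ^ n * ((T + n) * suc T)   ≡⟨ sym (*-assoc (T ^ n) (T + n) (suc T)) ⟩
  T ^ n * (T + n) * suc T     ≤⟨ *-monoˡ-≤ (suc T) (bernoulli T n) ⟩
  T * suc T ^ n * suc T       ≡⟨ regroup′ T (suc T ^ n) (suc T) ⟩
  T * (suc T * suc T ^ n)     ∎
  where
  open ≤-Reasoning
  regroup : ∀ a b c → a * b * c ≡ b * (a * c)
  regroup = solve-∀
  expand : ∀ T n → T * (T + suc n) + n ≡ (T + n) * suc T
  expand = solve-∀
  regroup′ : ∀ a b c → a * b * c ≡ a * (c * b)
  regroup′ = solve-∀

power-overtakes : ∀ T M k .{{_ : NonZero T}} → T * M ≤ k → T ^ k * M ≤ suc T ^ k
power-overtakes T M k TM≤k = *-cancelˡ-≤ T (begin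
  T * (T ^ k * M)   ≡⟨ regroup T (T ^ k) M ⟩
  T ^ k * (T * M)   ≤⟨ *-monoʳ-≤ (T ^ k) (≤-trans TM≤k (m≤n+m k T)) ⟩
  T ^ k * (T + k)   ≤⟨ bernoulli T k ⟩
  T * suc T ^ k     ∎)
  where
  open ≤-Reasoning
  regroup : ∀ a b c → a * (b * c) ≡ b * (a * c)
  regroup = solve-∀

module Trajectory (a : ℕ → ℕ) (a-pos : IsESequence a) (xs : ℕ → ℕ)
  (step : ∀ n → xs (suc n) * 2 ^ a (suc n) ≡ 3 * xs n + 1) where

  step-shifted : ∀ n → xs (suc n) * 2 ^ a (suc n) + 2 ≡ 3 * (xs n + 1)
  step-shifted n = trans (cong (_+ 2) (step n)) (shift (xs n))
    where
    shift : ∀ y → 3 * y + 1 + 2 ≡ 3 * (y + 1)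
    shift = solve-∀

  double-succ : ∀ y → y * 2 + 2 ≡ 2 * (y + 1)
  double-succ = solve-∀

  step-growth : ∀ n → 2 * (xs (suc n) + 1) ≤ 3 * (xs n + 1)
  step-growth n = begin
    2 * (xs (suc n) + 1)             ≡⟨ sym (double-succ (xs (suc n))) ⟩
    xs (suc n) * 2 + 2               ≤⟨ +-monoˡ-≤ 2 (*-monoʳ-≤ (xs (suc n)) (^-monoʳ-≤ 2 (a-pos (suc n) (s≤s z≤n)))) ⟩
    xs (suc n) * 2 ^ a (suc n) + 2   ≡⟨ step-shifted n ⟩
    3 * (xs n + 1)                   ∎
    where open ≤-Reasoning

  growth-bound : ∀ n → 2 ^ n * (xs n + 1) ≤ 3 ^ n * (xs 0 + 1)
  growth-bound zero = ≤-refl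
  growth-bound (suc n) = begin
    2 * 2 ^ n * (xs (suc n) + 1)     ≡⟨ regroup 2 (2 ^ n) (xs (suc n) + 1) ⟩
    2 ^ n * (2 * (xs (suc n) + 1))   ≤⟨ *-monoʳ-≤ (2 ^ n) (step-growth n) ⟩
    2 ^ n * (3 * (xs n + 1))         ≡⟨ exchange (2 ^ n) 3 (xs n + 1) ⟩
    3 * (2 ^ n * (xs n + 1))         ≤⟨ *-monoʳ-≤ 3 (growth-bound n) ⟩
    3 * (3 ^ n * (xs 0 + 1))         ≡⟨ sym (*-assoc 3 (3 ^ n) (xs 0 + 1)) ⟩
    3 * 3 ^ n * (xs 0 + 1)           ∎
    where
    open ≤-Reasoning
    regroup : ∀ a b c → a * b * c ≡ b * (a * c)
    regroup = solve-∀
    exchange : ∀ a b c → a * (b * c) ≡ b * (a * c)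
    exchange = solve-∀

  step-one : ∀ i → a (suc i) ≡ 1 → 2 * (xs (suc i) + 1) ≡ 3 * (xs i + 1)
  step-one i aᵢ₊₁≡1 = begin
    2 * (xs (suc i) + 1)             ≡⟨ sym (double-succ (xs (suc i))) ⟩
    xs (suc i) * 2 ^ 1 + 2           ≡⟨ cong (λ e → xs (suc i) * 2 ^ e + 2) (sym aᵢ₊₁≡1) ⟩
    xs (suc i) * 2 ^ a (suc i) + 2   ≡⟨ step-shifted i ⟩
    3 * (xs i + 1)                   ∎
    where open ≡-Reasoning

  run-divides : ∀ j i → (∀ t → i < t → t ≤ i + j → a t ≡ 1) → 2 ^ j ∣ xs i + 1
  run-divides zero i _ = 1∣ (xs i + 1)
  run-divides (suc j) i ones =
    coprime-pow-divisor 2 3 (xs i + 1) (suc j) (gcd≡1⇒coprime refl)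
      (subst (2 ^ suc j ∣_) (step-one i first-one) (*-monoʳ-∣ 2 (run-divides j (suc i) later-ones)))
    where
    first-one : a (suc i) ≡ 1
    first-one = ones (suc i) ≤-refl (subst (suc i ≤_) (sym (+-suc i j)) (s≤s (m≤m+n i j)))
    later-ones : ∀ t → suc i < t → t ≤ suc i + j → a t ≡ 1
    later-ones t i+1<t t≤ = ones t (<-trans (n<1+n i) i+1<t) (subst (t ≤_) (sym (+-suc i j)) t≤)

  run-bound : ∀ k l → (∀ t → k < t → t ≤ l → a t ≡ 1) → 2 ^ l ≤ 3 ^ k * (xs 0 + 1)
  run-bound k l ones with ≤-total k l
  ... | inj₁ k≤l = begin
    2 ^ l                ≡⟨ cong (2 ^_) (sym (m+[n∸m]≡n k≤l)) ⟩
    2 ^ (k + (l ∸ k))    ≡⟨ ^-distribˡ-+-* 2 k (l ∸ k) ⟩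
    2 ^ k * 2 ^ (l ∸ k)  ≤⟨ *-monoʳ-≤ (2 ^ k) (∣⇒≤ {{+1-nonZero (xs k)}} run) ⟩
    2 ^ k * (xs k + 1)   ≤⟨ growth-bound k ⟩
    3 ^ k * (xs 0 + 1)   ∎
    where
    open ≤-Reasoning
    run : 2 ^ (l ∸ k) ∣ xs k + 1
    run = run-divides (l ∸ k) k (λ t k<t t≤ → ones t k<t (subst (t ≤_) (m+[n∸m]≡n k≤l) t≤))
  ... | inj₂ l≤k = begin
    2 ^ l                ≤⟨ ^-monoʳ-≤ 2 l≤k ⟩
    2 ^ k                ≤⟨ ^-monoˡ-≤ k (s≤s (s≤s z≤n)) ⟩
    3 ^ k                ≤⟨ m≤m*n (3 ^ k) (xs 0 + 1) {{+1-nonZero (xs 0)}} ⟩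
    3 ^ k * (xs 0 + 1)   ∎
    where open ≤-Reasoning

  -- For a run of slope l/k above p/q, where 3^q < 2^p, raising the run bound
  -- to the q-th power gives (T + 1)^k < T^k M with T = 3^q, M = (x_0 + 1)^q.
  steep-run-dominated : ∀ p q k l → 3 ^ q < 2 ^ p → k * p < l * q →
    (∀ t → k < t → t ≤ l → a t ≡ 1) →
    suc (3 ^ q) ^ k < (3 ^ q) ^ k * (xs 0 + 1) ^ q
  steep-run-dominated p q k l 3^q<2^p slope ones = begin-strict
    suc (3 ^ q) ^ k          ≤⟨ ^-monoˡ-≤ k 3^q<2^p ⟩
    (2 ^ p) ^ k              ≡⟨ ^-*-assoc 2 p k ⟩
    2 ^ (p * k)              <⟨ ^-monoʳ-< 2 (s≤s (s≤s z≤n)) (subst (_< l * q) (*-comm k p) slope) ⟩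
    2 ^ (l * q)              ≡⟨ sym (^-*-assoc 2 l q) ⟩
    (2 ^ l) ^ q              ≤⟨ ^-monoˡ-≤ q (run-bound k l ones) ⟩
    (3 ^ k * (xs 0 + 1)) ^ q ≡⟨ ^-distribʳ-* (3 ^ k) (xs 0 + 1) q ⟩
    (3 ^ k) ^ q * M          ≡⟨ cong (_* M) (^-*-assoc 3 k q) ⟩
    3 ^ (k * q) * M          ≡⟨ cong (λ e → 3 ^ e * M) (*-comm k q) ⟩
    3 ^ (q * k) * M          ≡⟨ cong (_* M) (sym (^-*-assoc 3 q k)) ⟩
    (3 ^ q) ^ k * M          ∎
    where
    open ≤-Reasoning
    M : ℕ
    M = (xs 0 + 1) ^ q

  steep-run-limit : ℕ → ℕ
  steep-run-limit q = 3 ^ (3 ^ q * (xs 0 + 1) ^ q) * (xs 0 + 1)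

  -- Steep runs are short: Bernoulli rules out k ≥ T M, and k < T M bounds l.
  steep-run-bound : ∀ p q k l → 3 ^ q < 2 ^ p → k * p < l * q →
    (∀ t → k < t → t ≤ l → a t ≡ 1) → l < steep-run-limit q
  steep-run-bound p q k l 3^q<2^p slope ones with 3 ^ q * (xs 0 + 1) ^ q ≤? k
  ... | yes TM≤k = contradiction (power-overtakes (3 ^ q) ((xs 0 + 1) ^ q) k {{m^n≢0 3 q}} TM≤k)
                                 (<⇒≱ (steep-run-dominated p q k l 3^q<2^p slope ones))
  ... | no TM≰k = begin-strict
    l                    <⟨ n<2^n l ⟩
    2 ^ l                ≤⟨ run-bound k l ones ⟩
    3 ^ k * (xs 0 + 1)   ≤⟨ *-monoˡ-≤ (xs 0 + 1) (^-monoʳ-≤ 3 (<⇒≤ (≰⇒> TM≰k))) ⟩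
    steep-run-limit q    ∎
    where open ≤-Reasoning

-- Condition (ii) supplies runs of slope above p/q with arbitrarily large l,
-- which contradicts steep-run-bound for the trajectory of any x.
theorem4p11 : (a : ℕ → ℕ) → IsESequence a →
    (∀ n → 1 ≤ n → 2 ^ b a n < 3 ^ n) →
    (Σ ℕ λ p → Σ ℕ λ q → 1 ≤ q × 3 ^ q < 2 ^ p ×
      (∀ N → Σ ℕ λ k → Σ ℕ λ l → 1 ≤ k × N < l × k * p < l * q ×
        (∀ i → k < i → i ≤ l → a i ≡ 1))) →
    ΩDivergent a
theorem4p11 a a-pos _ (p , q , _ , 3^q<2^p , runs) (_ , _ , xs , _ , sequence-of) =
  let (k , l , _ , N<l , slope , ones) = runs N
  in  <-asym N<l (steep-run-bound p q k l 3^q<2^p slope ones)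
  where
  open Trajectory a a-pos xs (λ n → proj₂ (proj₂ (sequence-of n)))
  N : ℕ
  N = steep-run-limit q
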